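{- Let $p$ be a prime, $m$ a positive integer, and $n$ an even positive integer divisible by $p^m$. Let $1\le k\le n-1$ with $k$ divisible by $p$. Then both $\mathcal{P}_{n-1,k-1}$ and $\mathcal{N}_{n-1,k-1}$ are divisible by $p^m$, where $\mathcal{P}_{n-1,k-1}$ is the number of parity alternating permutations of $[n-1]$ with exactly $k-1$ ascents and $\mathcal{N}_{n-1,k-1}$ is the number of permutations of $[n-1]$ with exactly $k-1$ ascents that are not parity alternating.
   Context: A permutation $a_1a_2\cdots a_N$ of $[N]=\{1,\dots,N\}$ (one-line notation) is parity alternating if $a_i$ and $a_{i+1}$ have different parities for every $1\le i\le N-1$. An ascent is an index $i$ ($1\le i\le N-1$) with $a_i<a_{i+1}$. -}

module Defs where

open import Data.Nat using (ℕ; zero; suc; _+_; _≤_; _<_; _≟_; _<?_; _≤?_)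
open import Data.Nat.Properties using ()
open import Data.Nat.Base using (_%_)
open import Data.List using (List; []; _∷_; length; map; concatMap; filter; upTo; applyUpTo; concat)
open import Data.List.Relation.Unary.Unique.Propositional using (Unique)
open import Data.List.Relation.Unary.Unique.Propositional.Properties using ()
open import Data.List.Relation.Unary.All using (All; all?)
open import Data.List.Relation.Unary.AllPairs using (allPairs?)
open import Data.List.Relation.Unary.Linked using (Linked; linked?)
open import Data.Product using (_×_)
open import Relation.Nullary using (Dec; ¬_; yes; no; does)
open import Data.Bool using (if_then_else_)
open import Relation.Nullary.Decidable using (_×-dec_; ¬?)
open import Relation.Unary using (Decidable)
open import Relation.Binary.PropositionalEquality using (_≡_; _≢_)

range : ℕ → List ℕ
range N = applyUpTo suc N

words : ℕ → ℕ → List (List ℕ)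
words N zero    = [] ∷ []
words N (suc L) = concatMap (λ a → map (a ∷_) (words N L)) (range N)

-- a permutation of [N] in one-line notation: a word of length N over [N]
-- with pairwise distinct letters
IsPerm : ℕ → List ℕ → Set
IsPerm N w = (length w ≡ N) × (All (λ a → 1 ≤ a × a ≤ N) w × Unique w)

isPerm? : (N : ℕ) → Decidable (IsPerm N)
isPerm? N w = (length w ≟ N) ×-dec
              (all? (λ a → (1 ≤? a) ×-dec (a ≤? N)) w ×-dec
               allPairs? (λ x y → ¬? (x ≟ y)) w)

perms : ℕ → List (List ℕ)
perms N = filter (isPerm? N) (words N N)

ascentsFrom : ℕ → List ℕ → ℕ
ascentsFrom a []      = 0
ascentsFrom a (b ∷ w) = (if does (a <? b) then 1 else 0) + ascentsFrom b w

ascents : List ℕ → ℕ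
ascents []      = 0
ascents (a ∷ w) = ascentsFrom a w

DiffParity : ℕ → ℕ → Set
DiffParity a b = a % 2 ≢ b % 2

ParityAlternating : List ℕ → Set
ParityAlternating = Linked DiffParity

parityAlternating? : Decidable ParityAlternating
parityAlternating? = linked? (λ a b → ¬? (a % 2 ≟ b % 2))

𝒫 : ℕ → ℕ → ℕ
𝒫 N j = length (filter (λ w → parityAlternating? w ×-dec (ascents w ≟ j)) (perms N))

𝒩 : ℕ → ℕ → ℕ
𝒩 N j = length (filter (λ w → ¬? (parityAlternating? w) ×-dec (ascents w ≟ j)) (perms N))

module Submission where

-- Read a permutation w of [N], N = n − 1, as the cyclic sequence τ = 0 w on ℤ/n. Adding 1
-- modulo n and rotating back to start at 0 sends u N v to (v+1) 1 (u+1). This shift has order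
-- n, keeps the number of ascents and, as N is odd, keeps parity alternation; so both counted
-- sets are unions of shift-orbits, and it suffices that p^m divides every period j of every w
-- with k − 1 ascents (k cyclic ascents).
-- If shift^j w = w, then τ(i) ≡ τ(r + i) + j (mod n) for some r, so the cyclic gaps
-- (τ(i) − τ(i + 1)) mod n are r-periodic. Over n steps they sum to n k, hence over r steps to
-- r k, and n divides the sum over the first s steps plus τ(s). Taking s = (n / p d) r shows
-- that d ∣ r and p d ∣ n imply p d ∣ r, so p^m ∣ r; finally j ≡ −τ(r) ≡ r k (mod n).

open import Defs
open import Data.Nat
open import Data.Nat.Properties
open import Data.Nat.DivMod
open import Data.Nat.Divisibility
open import Data.Nat.Primality using (Prime; prime⇒nonZero)
open import Data.Nat.Tactic.RingSolver using (solve-∀)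
open import Data.Nat.GeneralisedArithmetic using (fold; fold-+; iterate-is-fold)
open import Data.List using (List; []; _∷_; length; map; _++_; filter; applyUpTo)
open import Data.List.Properties
  using (≡-dec; ∷-injectiveˡ; ∷-injectiveʳ; map-++; length-map; length-++; length-applyUpTo;
         filter-notAll; filter-++; filter-accept; filter-reject)
open import Data.List.Relation.Unary.Linked using (Linked; []; [-]; _∷_)
import Data.List.Relation.Unary.Linked as Linked
import Data.List.Relation.Unary.Linked.Properties as Linked
open import Data.List.Relation.Unary.Linked.Properties using (applyUpTo⁺₂)
open import Data.List.Membership.Propositional using (_∈_; _∉_)
open import Data.List.Membership.Propositional.Properties
  using (∈-filter⁺; ∈-filter⁻; ∈-map⁺; ∈-map⁻; ∈-applyUpTo⁺; ∈-concat⁺′; ∈-∃++)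
import Data.List.Membership.DecPropositional as DecMembership
open import Data.List.Relation.Binary.Subset.Propositional using (_⊆_)
open import Data.List.Relation.Unary.All using (All; []; _∷_)
import Data.List.Relation.Unary.All as All
import Data.List.Relation.Unary.All.Properties as All
import Data.List.Relation.Unary.AllPairs as AllPairs
import Data.List.Relation.Unary.AllPairs.Properties as AllPairs
open import Data.List.Relation.Binary.Disjoint.Propositional using (Disjoint)
open import Data.List.Relation.Unary.Any using (Any; here; there)
open import Data.List.Relation.Unary.Unique.Propositional using (Unique; []; _∷_)
import Data.List.Relation.Unary.Unique.Propositional.Properties as Unique
open import Data.Product using (∃; _×_; _,_; proj₁; proj₂; map₁)
open import Data.Sum using (_⊎_; inj₁; inj₂)
open import Function using (_∘_; case_of_)
open import Relation.Binary.Definitions using (DecidableEquality)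
open import Relation.Binary.PropositionalEquality
open import Relation.Nullary using (yes; no; ¬_; does; contradiction)
open import Data.Bool using (if_then_else_)
open import Relation.Nullary.Decidable using (¬?; _×-dec_; dec-true; dec-false)
open import Relation.Unary using (Pred; Decidable)
open import Level using (0ℓ)

-- Arithmetic modulo n and list indexing

%-+-congˡ : ∀ {x y} z {n} .{{_ : NonZero n}} → x % n ≡ y % n → (x + z) % n ≡ (y + z) % n
%-+-congˡ {x} {y} z {n} e = begin
  (x + z) % n             ≡⟨ %-distribˡ-+ x z n ⟩
  (x % n + z % n) % n     ≡⟨ cong (λ v → (v + z % n) % n) e ⟩
  (y % n + z % n) % n     ≡⟨ %-distribˡ-+ y z n ⟨
  (y + z) % n             ∎
  where open ≡-Reasoning

%-+-congʳ : ∀ x {y z n} .{{_ : NonZero n}} → y % n ≡ z % n → (x + y) % n ≡ (x + z) % n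
%-+-congʳ x {y} {z} e = subst₂ (λ a b → a % _ ≡ b % _) (+-comm y x) (+-comm z x) (%-+-congˡ x e)

%-+-cancelʳ : ∀ {x y} z {n} .{{_ : NonZero n}} → (x + z) % n ≡ (y + z) % n → x % n ≡ y % n
%-+-cancelʳ {x} {y} z {n@(suc n-1)} e = begin
  x % n                   ≡⟨ [m+kn]%n≡m%n x z n ⟨
  (x + z * n) % n         ≡⟨ cong (_% n) (add-n-copies x) ⟩
  (x + z + z * n-1) % n   ≡⟨ %-+-congˡ {x + z} {y + z} (z * n-1) e ⟩
  (y + z + z * n-1) % n   ≡⟨ cong (_% n) (add-n-copies y) ⟨
  (y + z * n) % n         ≡⟨ [m+kn]%n≡m%n y z n ⟩
  y % n                   ∎
  where
  open ≡-Reasoning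
  add-n-copies : ∀ w → w + z * n ≡ w + z + z * n-1
  add-n-copies w = trans (cong (w +_) (*-suc z n-1)) (sym (+-assoc w z _))

m<n⇒m+o∸n<o : ∀ {m n o} → m < n → n ≤ o → m + o ∸ n < o
m<n⇒m+o∸n<o {m} {n} {o} m<n n≤o = begin-strict
  m + o ∸ n       ≡⟨ +-∸-assoc m n≤o ⟩
  m + (o ∸ n)     <⟨ +-monoˡ-< (o ∸ n) m<n ⟩
  n + (o ∸ n)     ≡⟨ m+[n∸m]≡n n≤o ⟩
  o               ∎
  where open ≤-Reasoning

-- Junk value 0 past the end; only ever read at valid indices.
nth : List ℕ → ℕ → ℕ
nth []       _       = 0
nth (a ∷ _)  zero    = a
nth (_ ∷ xs) (suc i) = nth xs i

nth-++ˡ : ∀ xs ys {i} → i < length xs → nth (xs ++ ys) i ≡ nth xs i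
nth-++ˡ (x ∷ xs) ys {zero}  _          = refl
nth-++ˡ (x ∷ xs) ys {suc i} (s≤s i<xs) = nth-++ˡ xs ys i<xs

nth-++ʳ : ∀ xs ys i → nth (xs ++ ys) (length xs + i) ≡ nth ys i
nth-++ʳ []       ys i = refl
nth-++ʳ (x ∷ xs) ys i = nth-++ʳ xs ys i

nth-map : ∀ g xs {i} → i < length xs → nth (map g xs) i ≡ g (nth xs i)
nth-map g (x ∷ xs) {zero}  _          = refl
nth-map g (x ∷ xs) {suc i} (s≤s i<xs) = nth-map g xs i<xs

nth-∈ : ∀ xs {i} → i < length xs → nth xs i ∈ xs
nth-∈ (x ∷ xs) {zero}  _          = here refl
nth-∈ (x ∷ xs) {suc i} (s≤s i<xs) = there (nth-∈ xs i<xs)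

nth-ext : ∀ xs ys → length xs ≡ length ys → (∀ {i} → i < length xs → nth xs i ≡ nth ys i) → xs ≡ ys
nth-ext []       []       _   _  = refl
nth-ext (x ∷ xs) (y ∷ ys) len eq =
  cong₂ _∷_ (eq z<s) (nth-ext xs ys (suc-injective len) (eq ∘ s≤s))

nth-rotate : ∀ xs ys {n} .{{_ : NonZero n}} → length xs + length ys ≡ n → ∀ {i} → i < n →
             nth (ys ++ xs) i ≡ nth (xs ++ ys) ((length xs + i) % n)
nth-rotate xs ys {n} len {i} i<n with i <? length ys
... | yes i<ys = begin
  nth (ys ++ xs) i                   ≡⟨ nth-++ˡ ys xs i<ys ⟩
  nth ys i                           ≡⟨ nth-++ʳ xs ys i ⟨
  nth (xs ++ ys) (length xs + i)     ≡⟨ cong (nth (xs ++ ys)) (m<n⇒m%n≡m inside) ⟨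
  nth (xs ++ ys) ((length xs + i) % n) ∎
  where
  open ≡-Reasoning
  inside : length xs + i < n
  inside = subst (length xs + i <_) len (+-monoʳ-< (length xs) i<ys)
... | no i≮ys = begin
  nth (ys ++ xs) i                   ≡⟨ cong (nth (ys ++ xs)) i≡ys+i′ ⟩
  nth (ys ++ xs) (length ys + i′)    ≡⟨ nth-++ʳ ys xs i′ ⟩
  nth xs i′                          ≡⟨ nth-++ˡ xs ys i′<xs ⟨
  nth (xs ++ ys) i′                  ≡⟨ cong (nth (xs ++ ys)) (m<n⇒m%n≡m i′<n) ⟨
  nth (xs ++ ys) (i′ % n)            ≡⟨ cong (nth (xs ++ ys)) ([m+n]%n≡m%n i′ n) ⟨
  nth (xs ++ ys) ((i′ + n) % n)      ≡⟨ cong (λ v → nth (xs ++ ys) (v % n)) wrap ⟩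
  nth (xs ++ ys) ((length xs + i) % n) ∎
  where
  open ≡-Reasoning
  i′ = i ∸ length ys
  i≡ys+i′ : i ≡ length ys + i′
  i≡ys+i′ = sym (m+[n∸m]≡n (≮⇒≥ i≮ys))
  i′<xs : i′ < length xs
  i′<xs = +-cancelˡ-< (length ys) i′ (length xs)
    (subst₂ _<_ i≡ys+i′ (trans (sym len) (+-comm (length xs) (length ys))) i<n)
  i′<n : i′ < n
  i′<n = <-≤-trans i′<xs (subst (length xs ≤_) len (m≤m+n (length xs) (length ys)))
  wrap : i′ + n ≡ length xs + i
  wrap = begin
    i′ + n                             ≡⟨ cong (i′ +_) (trans (sym len) (+-comm (length xs) (length ys))) ⟩
    i′ + (length ys + length xs)       ≡⟨ +-assoc i′ (length ys) (length xs) ⟨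
    i′ + length ys + length xs         ≡⟨ cong (_+ length xs) (trans (+-comm i′ (length ys)) (sym i≡ys+i′)) ⟩
    i + length xs                      ≡⟨ +-comm i (length xs) ⟩
    length xs + i                      ∎

lastOf : ℕ → List ℕ → ℕ
lastOf a []       = a
lastOf a (b ∷ xs) = lastOf b xs

lastOf-++ : ∀ a xs b ys → lastOf a (xs ++ b ∷ ys) ≡ lastOf b ys
lastOf-++ a []       b ys = refl
lastOf-++ a (x ∷ xs) b ys = lastOf-++ x xs b ys

lastOf-∈ : ∀ a xs → lastOf a xs ∈ a ∷ xs
lastOf-∈ a []       = here refl
lastOf-∈ a (x ∷ xs) = there (lastOf-∈ x xs)

lastOf-map : ∀ g a xs → lastOf (g a) (map g xs) ≡ g (lastOf a xs)
lastOf-map g a []       = refl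
lastOf-map g a (x ∷ xs) = lastOf-map g x xs

-- Counting orbits

least : {P : Pred ℕ 0ℓ} → Decidable P → ∀ n {j} → j ≤ n → P j →
        ∃ λ m → P m × (∀ {i} → i < m → ¬ P i)
least P? n {j} j≤n pj with anyUpTo? P? j
least P? n       {j} j≤n pj | no none = j , pj , λ i<j pi → none (_ , i<j , pi)
least P? (suc n) {j} j≤n pj | yes (i , i<j , pi) = least P? n (≤-pred (<-≤-trans i<j j≤n)) pi
least P? zero    z≤n     pj | yes (i , () , _)

length-filter-split : {A : Set} {P : Pred A 0ℓ} (P? : Decidable P) (xs : List A) →
  length xs ≡ length (filter P? xs) + length (filter (¬? ∘ P?) xs)
length-filter-split P? []       = refl
length-filter-split P? (x ∷ xs) with P? x
... | yes _ = cong suc (length-filter-split P? xs)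
... | no  _ = trans (cong suc (length-filter-split P? xs)) (sym (+-suc _ _))

module _ {A : Set} (_≟_ : DecidableEquality A) where

  open DecMembership _≟_ using (_∈?_)

  unique-⊆⇒length≤ : ∀ {xs ys : List A} → Unique xs → xs ⊆ ys → length xs ≤ length ys
  unique-⊆⇒length≤ {[]}     _          _   = z≤n
  unique-⊆⇒length≤ {x ∷ xs} {ys} (x∉xs ∷ u) sub =
    ≤-trans (s≤s (unique-⊆⇒length≤ u sub′)) (filter-notAll (¬? ∘ (_≟ x)) ys (x∈⇒any (sub (here refl))))
    where
    x∈⇒any : ∀ {zs} → x ∈ zs → Any (λ z → ¬ ¬ z ≡ x) zs
    x∈⇒any (here refl) = here (λ z≢x → z≢x refl)
    x∈⇒any (there p)   = there (x∈⇒any p)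
    ≢x : ∀ {zs y} → All (x ≢_) zs → y ∈ zs → y ≢ x
    ≢x (x≢z ∷ _) (here refl) refl = x≢z refl
    ≢x (_ ∷ ps)  (there p)        = ≢x ps p
    sub′ : xs ⊆ filter (¬? ∘ (_≟ x)) ys
    sub′ p = ∈-filter⁺ (¬? ∘ (_≟ x)) (sub (there p)) (≢x x∉xs p)

  length-filter-∈ : ∀ {xs ys : List A} → Unique xs → Unique ys → ys ⊆ xs →
                    length (filter (_∈? ys) xs) ≡ length ys
  length-filter-∈ {xs} {ys} uxs uys ys⊆xs = ≤-antisym
    (unique-⊆⇒length≤ (Unique.filter⁺ (_∈? ys) uxs) (proj₂ ∘ ∈-filter⁻ (_∈? ys) {xs = xs}))
    (unique-⊆⇒length≤ uys (λ p → ∈-filter⁺ (_∈? ys) (ys⊆xs p) p))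

module Orbits {A : Set} (_≟_ : DecidableEquality A) (f : A → A) where

  open DecMembership _≟_ using (_∈?_)

  iter : ℕ → A → A
  iter j x = fold x f j

  iter-+ : ∀ a b x → iter (a + b) x ≡ iter a (iter b x)
  iter-+ a b x = fold-+ x f a

  iter-suc : ∀ j x → iter (suc j) x ≡ iter j (f x)
  iter-suc j x = trans (iterate-is-fold x f (suc j)) (sym (iterate-is-fold (f x) f j))

  PeriodsDivisibleBy : ℕ → A → Set
  PeriodsDivisibleBy q x = ∀ {j} → iter j x ≡ x → q ∣ j

  orbit : A → ℕ → List A
  orbit x zero    = []
  orbit x (suc o) = iter o x ∷ orbit x o

  length-orbit : ∀ x o → length (orbit x o) ≡ o
  length-orbit x zero    = refl
  length-orbit x (suc o) = cong suc (length-orbit x o)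

  ∈-orbit⁺ : ∀ {x i o} → i < o → iter i x ∈ orbit x o
  ∈-orbit⁺ {o = suc o} i<1+o with m≤n⇒m<n∨m≡n (≤-pred i<1+o)
  ... | inj₁ i<o  = there (∈-orbit⁺ i<o)
  ... | inj₂ refl = here refl

  ∈-orbit⁻ : ∀ {x y o} → y ∈ orbit x o → ∃ λ i → i < o × y ≡ iter i x
  ∈-orbit⁻ {o = suc o} (here y≡) = o , ≤-refl , y≡
  ∈-orbit⁻ {o = suc o} (there p) with ∈-orbit⁻ p
  ... | i , i<o , y≡ = i , m<n⇒m<1+n i<o , y≡

  orbit-unique : ∀ x o → (∀ {i i′} → i < i′ → i′ < o → iter i x ≢ iter i′ x) → Unique (orbit x o)
  orbit-unique x zero    distinct = []
  orbit-unique x (suc o) distinct =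
    All-≢ (orbit x o) (λ p → p) ∷ orbit-unique x o (λ i<i′ i′<o → distinct i<i′ (m<n⇒m<1+n i′<o))
    where
    All-≢ : ∀ ys → ys ⊆ orbit x o → All (iter o x ≢_) ys
    All-≢ []       _   = []
    All-≢ (y ∷ ys) sub with ∈-orbit⁻ (sub (here refl))
    ... | i , i<o , refl = (λ e → distinct i<o ≤-refl (sym e)) ∷ All-≢ ys (sub ∘ there)

  minimal-period⇒distinct : ∀ {x o} → iter o x ≡ x → (∀ {i} → 0 < i → i < o → iter i x ≢ x) →
                            ∀ {i i′} → i < i′ → i′ < o → iter i x ≢ iter i′ x
  minimal-period⇒distinct {x} {o} period minimal {i} {i′} i<i′ i′<o e =
    minimal (<-≤-trans (m<n⇒0<n∸m i′<o) (m≤m+n d i)) shorter returns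
    where
    d = o ∸ i′
    d+i′≡o : d + i′ ≡ o
    d+i′≡o = m∸n+n≡m (<⇒≤ i′<o)
    shorter : d + i < o
    shorter = subst (d + i <_) d+i′≡o (+-monoʳ-< d i<i′)
    returns : iter (d + i) x ≡ x
    returns = begin
      iter (d + i) x        ≡⟨ iter-+ d i x ⟩
      iter d (iter i x)     ≡⟨ cong (iter d) e ⟩
      iter d (iter i′ x)    ≡⟨ iter-+ d i′ x ⟨
      iter (d + i′) x       ≡⟨ cong (λ t → iter t x) d+i′≡o ⟩
      iter o x              ≡⟨ period ⟩
      x                     ∎
      where open ≡-Reasoning

  private
    orbit-preimage : ∀ {x o} → 0 < o → iter o x ≡ x → ∀ {i} → i < o →
                  ∃ λ i′ → i′ < o × iter i x ≡ f (iter i′ x)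
    orbit-preimage {x} {suc o} _ period {zero}  _     = o , ≤-refl , sym period
    orbit-preimage             _ _      {suc i} i+1<o = i , <-trans (n<1+n i) i+1<o , refl

  module _ {n} (0<n : 0 < n) {L : List A} (closed : ∀ {x} → x ∈ L → f x ∈ L)
           (periodic : ∀ {x} → x ∈ L → iter n x ≡ x) where

    injective-on : ∀ {y z} → y ∈ L → z ∈ L → f y ≡ f z → y ≡ z
    injective-on {y} {z} y∈L z∈L e = begin
      y                  ≡⟨ periodic y∈L ⟨
      iter n y           ≡⟨ cong (λ t → iter t y) n≡1+n-1 ⟩
      iter (suc n-1) y   ≡⟨ iter-suc n-1 y ⟩
      iter n-1 (f y)     ≡⟨ cong (iter n-1) e ⟩
      iter n-1 (f z)     ≡⟨ iter-suc n-1 z ⟨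
      iter (suc n-1) z   ≡⟨ cong (λ t → iter t z) n≡1+n-1 ⟨
      iter n z           ≡⟨ periodic z∈L ⟩
      z                  ∎
      where
      open ≡-Reasoning
      n-1 = n ∸ 1
      n≡1+n-1 : n ≡ suc n-1
      n≡1+n-1 = sym (m+[n∸m]≡n 0<n)

    iter-∈ : ∀ {x} → x ∈ L → ∀ i → iter i x ∈ L
    iter-∈ x∈L zero    = x∈L
    iter-∈ x∈L (suc i) = closed (iter-∈ x∈L i)

    module RemoveOrbit {x} (x∈L : x ∈ L) {o} (0<o : 0 < o) (period : iter o x ≡ x) where

      rest : List A
      rest = filter (¬? ∘ (_∈? orbit x o)) L

      length-rest : Unique L → Unique (orbit x o) → length L ≡ o + length rest
      length-rest uL uO = trans (length-filter-split (_∈? orbit x o) L)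
        (cong (_+ length rest) (trans (length-filter-∈ _≟_ uL uO orbit⊆L) (length-orbit x o)))
        where
        orbit⊆L : orbit x o ⊆ L
        orbit⊆L p with ∈-orbit⁻ p
        ... | i , _ , refl = iter-∈ x∈L i

      rest-closed : ∀ {y} → y ∈ rest → f y ∈ rest
      rest-closed {y} p with ∈-filter⁻ (¬? ∘ (_∈? orbit x o)) {xs = L} p
      ... | y∈L , y∉O = ∈-filter⁺ (¬? ∘ (_∈? orbit x o)) (closed y∈L) fy∉O
        where
        fy∉O : f y ∉ orbit x o
        fy∉O q with ∈-orbit⁻ q
        ... | i , i<o , fy≡ with orbit-preimage 0<o period i<o
        ... | i′ , i′<o , e =
          y∉O (subst (_∈ orbit x o) (injective-on (iter-∈ x∈L i′) y∈L (sym (trans fy≡ e))) (∈-orbit⁺ i′<o))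

      rest-⊆ : rest ⊆ L
      rest-⊆ = proj₁ ∘ ∈-filter⁻ (¬? ∘ (_∈? orbit x o)) {xs = L}

      rest-unique : Unique L → Unique rest
      rest-unique = Unique.filter⁺ (¬? ∘ (_∈? orbit x o))

  -- L is a disjoint union of orbits, each with as many points as the least period of its points.
  ∣-length-of-invariant : ∀ q {n} → 0 < n → (L : List A) → Unique L →
    (∀ {x} → x ∈ L → f x ∈ L) → (∀ {x} → x ∈ L → iter n x ≡ x) →
    (∀ {x} → x ∈ L → PeriodsDivisibleBy q x) → q ∣ length L
  ∣-length-of-invariant q {n} 0<n L = count (length L) L ≤-refl
    where
    count : ∀ s L → length L ≤ s → Unique L → (∀ {x} → x ∈ L → f x ∈ L) →
            (∀ {x} → x ∈ L → iter n x ≡ x) → (∀ {x} → x ∈ L → PeriodsDivisibleBy q x) → q ∣ length L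
    count _       []          _   _  _      _        _       = q ∣0
    count zero    (_ ∷ _)   ()
    count (suc s) L@(x ∷ _) len uL closed periodic q∣periods =
      subst (q ∣_) (sym (length-rest uL uO))
        (∣m∣n⇒∣m+n (q∣periods (here refl) period)
          (count s rest rest-shorter (rest-unique uL) rest-closed (periodic ∘ rest-⊆) (q∣periods ∘ rest-⊆)))
      where
      has-period? : Decidable (λ j → 0 < j × iter j x ≡ x)
      has-period? j = (0 <? j) ×-dec (iter j x ≟ x)
      least-period : ∃ λ o → (0 < o × iter o x ≡ x) × (∀ {i} → i < o → ¬ (0 < i × iter i x ≡ x))
      least-period = least has-period? n ≤-refl (0<n , periodic (here refl))
      o : ℕ
      o = proj₁ least-period
      0<o : 0 < o
      0<o = proj₁ (proj₁ (proj₂ least-period))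
      period : iter o x ≡ x
      period = proj₂ (proj₁ (proj₂ least-period))
      uO : Unique (orbit x o)
      uO = orbit-unique x o (minimal-period⇒distinct period
             (λ 0<i i<o e → proj₂ (proj₂ least-period) i<o (0<i , e)))
      open RemoveOrbit 0<n closed periodic (here refl) 0<o period
      rest-shorter : length rest ≤ s
      rest-shorter = ≤-pred (≤-trans (+-monoˡ-≤ (length rest) 0<o) (subst (_≤ suc s) (length-rest uL uO) len))

-- Ascents and cyclic sequences

ascent : ℕ → ℕ → ℕ
ascent a b = if does (a <? b) then 1 else 0

ascent-< : ∀ {a b} → a < b → ascent a b ≡ 1
ascent-< {a} {b} a<b = cong (λ d → if d then 1 else 0) (dec-true (a <? b) a<b)

ascent-≮ : ∀ {a b} → ¬ a < b → ascent a b ≡ 0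
ascent-≮ {a} {b} a≮b = cong (λ d → if d then 1 else 0) (dec-false (a <? b) a≮b)

ascentsUpTo : (ℕ → ℕ) → ℕ → ℕ
ascentsUpTo g zero    = 0
ascentsUpTo g (suc i) = ascentsUpTo g i + ascent (g i) (g (suc i))

ascentsUpTo-front : ∀ g i → ascentsUpTo g (suc i) ≡ ascent (g 0) (g 1) + ascentsUpTo (g ∘ suc) i
ascentsUpTo-front g zero    = +-comm 0 _
ascentsUpTo-front g (suc i) =
  trans (cong (_+ ascent (g (suc i)) (g (suc (suc i)))) (ascentsUpTo-front g i)) (+-assoc (ascent (g 0) (g 1)) _ _)

ascentsUpTo-cong : ∀ g h i → (∀ {k} → k ≤ i → g k ≡ h k) → ascentsUpTo g i ≡ ascentsUpTo h i
ascentsUpTo-cong g h zero    _   = refl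
ascentsUpTo-cong g h (suc i) g≗h =
  cong₂ _+_ (ascentsUpTo-cong g h i (g≗h ∘ m≤n⇒m≤1+n)) (cong₂ ascent (g≗h (n≤1+n i)) (g≗h ≤-refl))

ascentsFrom≡ascentsUpTo : ∀ a xs → ascentsFrom a xs ≡ ascentsUpTo (nth (a ∷ xs)) (length xs)
ascentsFrom≡ascentsUpTo a []       = refl
ascentsFrom≡ascentsUpTo a (b ∷ xs) =
  trans (cong (ascent a b +_) (ascentsFrom≡ascentsUpTo b xs)) (sym (ascentsUpTo-front (nth (a ∷ b ∷ xs)) (length xs)))

ascentsFrom-++ : ∀ a xs b ys →
  ascentsFrom a (xs ++ b ∷ ys) ≡ ascentsFrom a xs + ascent (lastOf a xs) b + ascentsFrom b ys
ascentsFrom-++ a []       b ys = refl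
ascentsFrom-++ a (x ∷ xs) b ys = trans (cong (ascent a x +_) (ascentsFrom-++ x xs b ys))
  (trans (sym (+-assoc (ascent a x) _ _)) (cong (_+ ascentsFrom b ys) (sym (+-assoc (ascent a x) _ _))))

ascentsFrom-map-suc : ∀ a xs → ascentsFrom (suc a) (map suc xs) ≡ ascentsFrom a xs
ascentsFrom-map-suc a []       = refl
ascentsFrom-map-suc a (x ∷ xs) = cong (ascent a x +_) (ascentsFrom-map-suc x xs)

ascentsFrom-≥ : ∀ {a} xs → All (_≤ a) xs → ascentsFrom a xs ≡ ascents xs
ascentsFrom-≥ []       _          = refl
ascentsFrom-≥ (b ∷ xs) (b≤a ∷ _)  = cong (_+ ascentsFrom b xs) (ascent-≮ (≤⇒≯ b≤a))

-- Intended τ: a bijection of ℤ/n fixing 0, as an n-periodic sequence; ascentsUpTo τ n is then its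
-- number of cyclic ascents.
module CyclicSequence (n : ℕ) .{{_ : NonZero n}} (τ : ℕ → ℕ) (τ<n : ∀ i → τ i < n)
  (τ-periodic : ∀ i → τ (n + i) ≡ τ i) (τ0≡0 : τ 0 ≡ 0) (τ≡0⇒n∣ : ∀ i → τ i ≡ 0 → n ∣ i) where

  -- τ i − τ (i + 1) read in ℤ/n; the + n keeps the truncated subtraction exact.
  gap : ℕ → ℕ
  gap i = (τ i + n ∸ τ (suc i)) % n

  gapSum : ℕ → ℕ
  gapSum zero    = 0
  gapSum (suc i) = gapSum i + gap i

  gap-spec : ∀ i → gap i + τ (suc i) ≡ τ i + n * ascent (τ i) (τ (suc i))
  gap-spec i with τ i <? τ (suc i)
  ... | yes τi<τi+1 = begin
    (τ i + n ∸ τ (suc i)) % n + τ (suc i)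
      ≡⟨ cong (_+ τ (suc i)) (m<n⇒m%n≡m (m<n⇒m+o∸n<o τi<τi+1 (<⇒≤ (τ<n (suc i))))) ⟩
    τ i + n ∸ τ (suc i) + τ (suc i)       ≡⟨ m∸n+n≡m (≤-trans (<⇒≤ (τ<n (suc i))) (m≤n+m n (τ i))) ⟩
    τ i + n                               ≡⟨ cong (τ i +_) (*-identityʳ n) ⟨
    τ i + n * 1                           ≡⟨ cong (λ v → τ i + n * v) (ascent-< τi<τi+1) ⟨
    τ i + n * ascent (τ i) (τ (suc i))    ∎
    where open ≡-Reasoning
  ... | no τi≮τi+1 = begin
    (τ i + n ∸ τ (suc i)) % n + τ (suc i) ≡⟨ cong (λ v → v % n + τ (suc i)) reorder ⟩
    (τ i ∸ τ (suc i) + n) % n + τ (suc i) ≡⟨ cong (_+ τ (suc i)) ([m+n]%n≡m%n (τ i ∸ τ (suc i)) n) ⟩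
    (τ i ∸ τ (suc i)) % n + τ (suc i)
      ≡⟨ cong (_+ τ (suc i)) (m<n⇒m%n≡m (≤-<-trans (m∸n≤m (τ i) (τ (suc i))) (τ<n i))) ⟩
    τ i ∸ τ (suc i) + τ (suc i)           ≡⟨ m∸n+n≡m τi+1≤τi ⟩
    τ i                                   ≡⟨ +-identityʳ (τ i) ⟨
    τ i + 0                               ≡⟨ cong (τ i +_) (*-zeroʳ n) ⟨
    τ i + n * 0                           ≡⟨ cong (λ v → τ i + n * v) (ascent-≮ τi≮τi+1) ⟨
    τ i + n * ascent (τ i) (τ (suc i))    ∎
    where
    open ≡-Reasoning
    τi+1≤τi = ≮⇒≥ τi≮τi+1
    reorder : τ i + n ∸ τ (suc i) ≡ τ i ∸ τ (suc i) + n
    reorder = trans (cong (_∸ τ (suc i)) (+-comm (τ i) n)) (trans (+-∸-assoc n τi+1≤τi) (+-comm n _))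

  gap-spec-% : ∀ i → (gap i + τ (suc i)) % n ≡ τ i % n
  gap-spec-% i = trans (cong (_% n) (gap-spec i))
    (trans (cong (λ v → (τ i + v) % n) (*-comm n a)) ([m+kn]%n≡m%n (τ i) a n))
    where a = ascent (τ i) (τ (suc i))

  gapSum-telescopes : ∀ i → gapSum i + τ i ≡ n * ascentsUpTo τ i
  gapSum-telescopes zero    = trans (cong (0 +_) τ0≡0) (sym (*-zeroʳ n))
  gapSum-telescopes (suc i) = begin
    gapSum i + gap i + τ (suc i)          ≡⟨ +-assoc (gapSum i) _ _ ⟩
    gapSum i + (gap i + τ (suc i))        ≡⟨ cong (gapSum i +_) (gap-spec i) ⟩
    gapSum i + (τ i + n * a)              ≡⟨ +-assoc (gapSum i) (τ i) (n * a) ⟨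
    gapSum i + τ i + n * a                ≡⟨ cong (_+ n * a) (gapSum-telescopes i) ⟩
    n * ascentsUpTo τ i + n * a           ≡⟨ *-distribˡ-+ n (ascentsUpTo τ i) a ⟨
    n * ascentsUpTo τ (suc i)             ∎
    where
    open ≡-Reasoning
    a = ascent (τ i) (τ (suc i))

  n∣gapSum+τ : ∀ i → n ∣ gapSum i + τ i
  n∣gapSum+τ i = divides (ascentsUpTo τ i) (trans (gapSum-telescopes i) (*-comm n _))

  gapSum-period : gapSum n ≡ n * ascentsUpTo τ n
  gapSum-period = begin
    gapSum n         ≡⟨ +-identityʳ (gapSum n) ⟨
    gapSum n + 0
      ≡⟨ cong (gapSum n +_) (trans (sym τ0≡0) (trans (sym (τ-periodic 0)) (cong τ (+-identityʳ n)))) ⟩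
    gapSum n + τ n   ≡⟨ gapSum-telescopes n ⟩
    n * ascentsUpTo τ n ∎
    where open ≡-Reasoning

  gap-periodic : ∀ i → gap (n + i) ≡ gap i
  gap-periodic i =
    cong₂ (λ a b → (a + n ∸ b) % n) (τ-periodic i) (trans (cong τ (sym (+-suc n i))) (τ-periodic (suc i)))

  module _ (c : ℕ) (gap-periodic-c : ∀ i → gap (c + i) ≡ gap i) where

    gapSum-+ : ∀ i → gapSum (c + i) ≡ gapSum c + gapSum i
    gapSum-+ zero    = trans (cong gapSum (+-identityʳ c)) (sym (+-identityʳ (gapSum c)))
    gapSum-+ (suc i) = begin
      gapSum (c + suc i)                   ≡⟨ cong gapSum (+-suc c i) ⟩
      gapSum (c + i) + gap (c + i)         ≡⟨ cong₂ _+_ (gapSum-+ i) (gap-periodic-c i) ⟩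
      gapSum c + gapSum i + gap i          ≡⟨ +-assoc (gapSum c) _ _ ⟩
      gapSum c + gapSum (suc i)            ∎
      where open ≡-Reasoning

    gapSum-* : ∀ a → gapSum (a * c) ≡ a * gapSum c
    gapSum-* zero    = refl
    gapSum-* (suc a) = trans (gapSum-+ (a * c)) (cong (gapSum c +_) (gapSum-* a))

  module _ {r j : ℕ} (invariant : ∀ i → τ i ≡ (τ (r + i) + j) % n) where

    gap-shift : ∀ i → gap (r + i) ≡ gap i
    gap-shift i = begin
      gap (r + i)          ≡⟨ m%n%n≡m%n _ n ⟨
      gap (r + i) % n      ≡⟨ %-+-cancelʳ c same-after-adding-c ⟩
      gap i % n            ≡⟨ m%n%n≡m%n _ n ⟩
      gap i                ∎
      where
      open ≡-Reasoning
      c = τ (r + suc i) + j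
      τ[1+i]≡c : τ (suc i) % n ≡ c % n
      τ[1+i]≡c = trans (cong (_% n) (invariant (suc i))) (m%n%n≡m%n c n)
      same-after-adding-c : (gap (r + i) + c) % n ≡ (gap i + c) % n
      same-after-adding-c = begin
        (gap (r + i) + (τ (r + suc i) + j)) % n   ≡⟨ cong (λ v → (gap (r + i) + (τ v + j)) % n) (+-suc r i) ⟩
        (gap (r + i) + (τ (suc (r + i)) + j)) % n ≡⟨ cong (_% n) (+-assoc (gap (r + i)) _ j) ⟨
        (gap (r + i) + τ (suc (r + i)) + j) % n   ≡⟨ %-+-congˡ j (gap-spec-% (r + i)) ⟩
        (τ (r + i) + j) % n                       ≡⟨ invariant i ⟨
        τ i                                       ≡⟨ m<n⇒m%n≡m (τ<n i) ⟨
        τ i % n                                   ≡⟨ gap-spec-% i ⟨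
        (gap i + τ (suc i)) % n                   ≡⟨ %-+-congʳ (gap i) τ[1+i]≡c ⟩
        (gap i + c) % n                           ∎

    gapSum-shift : gapSum r ≡ r * ascentsUpTo τ n
    gapSum-shift = *-cancelˡ-≡ (gapSum r) (r * k) n (begin
      n * gapSum r          ≡⟨ gapSum-* r gap-shift n ⟨
      gapSum (n * r)        ≡⟨ cong gapSum (*-comm n r) ⟩
      gapSum (r * n)        ≡⟨ gapSum-* n gap-periodic r ⟩
      r * gapSum n          ≡⟨ cong (r *_) gapSum-period ⟩
      r * (n * k)           ≡⟨ *-assoc r n k ⟨
      r * n * k             ≡⟨ cong (_* k) (*-comm r n) ⟩
      n * r * k             ≡⟨ *-assoc n r k ⟩
      n * (r * k)           ∎)
      where
      open ≡-Reasoning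
      k = ascentsUpTo τ n

    module _ {p} (p∣k : p ∣ ascentsUpTo τ n) where

      -- The index t r, with n = t p d, is a multiple of n because τ vanishes there.
      p*d∣r : ∀ d .{{_ : NonZero d}} → p * d ∣ n → d ∣ r → p * d ∣ r
      p*d∣r d pd∣n d∣r = *-cancelˡ-∣ t (subst (_∣ t * r) n≡t*pd (τ≡0⇒n∣ (t * r) τ[tr]≡0))
        where
        t = quotient pd∣n
        n≡t*pd : n ≡ t * (p * d)
        n≡t*pd = m∣n⇒n≡quotient*m pd∣n
        instance
          t≢0 : NonZero t
          t≢0 = quotient≢0 pd∣n
        r′ = quotient d∣r
        k′ = quotient p∣k
        gapSum[tr] : gapSum (t * r) ≡ (r′ * k′) * n
        gapSum[tr] = begin
          gapSum (t * r)                    ≡⟨ gapSum-* r gap-shift t ⟩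
          t * gapSum r                      ≡⟨ cong (t *_) gapSum-shift ⟩
          t * (r * ascentsUpTo τ n)
            ≡⟨ cong₂ (λ a b → t * (a * b)) (m∣n⇒n≡quotient*m d∣r) (m∣n⇒n≡quotient*m p∣k) ⟩
          t * ((r′ * d) * (k′ * p))         ≡⟨ rearrange t r′ d k′ p ⟩
          (r′ * k′) * (t * (p * d))         ≡⟨ cong ((r′ * k′) *_) n≡t*pd ⟨
          (r′ * k′) * n                     ∎
          where
          open ≡-Reasoning
          rearrange : ∀ t r′ d k′ p → t * ((r′ * d) * (k′ * p)) ≡ (r′ * k′) * (t * (p * d))
          rearrange = solve-∀
        n∣τ[tr] : n ∣ τ (t * r)
        n∣τ[tr] = ∣m+n∣m⇒∣n (n∣gapSum+τ (t * r)) (subst (n ∣_) (sym gapSum[tr]) (n∣m*n (r′ * k′)))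
        τ[tr]≡0 : τ (t * r) ≡ 0
        τ[tr]≡0 = trans (sym (m<n⇒m%n≡m (τ<n (t * r)))) (n∣m⇒m%n≡0 _ n n∣τ[tr])

      module _ .{{_ : NonZero p}} where

        p^a∣r : ∀ a → p ^ a ∣ n → p ^ a ∣ r
        p^a∣r zero    _         = 1∣ r
        p^a∣r (suc a) p^[1+a]∣n =
          p*d∣r (p ^ a) {{m^n≢0 p a}} p^[1+a]∣n (p^a∣r a (∣-trans (n∣m*n p) p^[1+a]∣n))

        p^m∣j : ∀ m → p ^ m ∣ n → p ^ m ∣ j
        p^m∣j m p^m∣n = ∣m+n∣m⇒∣n p^m∣τr+j p^m∣τr
          where
          p^m∣gapSum : p ^ m ∣ gapSum r
          p^m∣gapSum = subst (p ^ m ∣_) (sym gapSum-shift) (∣m⇒∣m*n (ascentsUpTo τ n) (p^a∣r m p^m∣n))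
          p^m∣τr : p ^ m ∣ τ r
          p^m∣τr = ∣m+n∣m⇒∣n (∣-trans p^m∣n (n∣gapSum+τ r)) p^m∣gapSum
          n∣τr+j : n ∣ τ r + j
          n∣τr+j = m%n≡0⇒n∣m _ n (trans (cong (λ v → (τ v + j) % n) (sym (+-identityʳ r)))
                                        (trans (sym (invariant 0)) τ0≡0))
          p^m∣τr+j : p ^ m ∣ τ r + j
          p^m∣τr+j = ∣-trans p^m∣n n∣τr+j

-- Parity

Odd : ℕ → Set
Odd a = a % 2 ≡ 1

%2≡0⊎%2≡1 : ∀ a → a % 2 ≡ 0 ⊎ a % 2 ≡ 1
%2≡0⊎%2≡1 a with a % 2 | m%n<n a 2
... | 0           | _                 = inj₁ refl
... | 1           | _                 = inj₂ refl
... | suc (suc _) | s≤s (s≤s ())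

[1+a]%2≡1∸a%2 : ∀ a → suc a % 2 ≡ 1 ∸ a % 2
[1+a]%2≡1∸a%2 zero          = refl
[1+a]%2≡1∸a%2 (suc zero)    = refl
[1+a]%2≡1∸a%2 (suc (suc a)) = [1+a]%2≡1∸a%2 a

DiffParity-suc : ∀ {a b} → DiffParity a b → DiffParity (suc a) (suc b)
DiffParity-suc {a} {b} a≁b e
  with %2≡0⊎%2≡1 a | %2≡0⊎%2≡1 b | trans (sym ([1+a]%2≡1∸a%2 a)) (trans e ([1+a]%2≡1∸a%2 b))
... | inj₁ a0 | inj₁ b0 | _ = a≁b (trans a0 (sym b0))
... | inj₂ a1 | inj₂ b1 | _ = a≁b (trans a1 (sym b1))
... | inj₁ a0 | inj₂ b1 | e′ rewrite a0 | b1 = case e′ of λ ()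
... | inj₂ a1 | inj₁ b0 | e′ rewrite a1 | b0 = case e′ of λ ()

DiffParity-twice : ∀ {a b c} → DiffParity a b → DiffParity b c → c % 2 ≡ a % 2
DiffParity-twice {a} {b} {c} a≁b b≁c with %2≡0⊎%2≡1 a | %2≡0⊎%2≡1 b | %2≡0⊎%2≡1 c
... | inj₁ a0 | inj₁ b0 | _       = contradiction (trans a0 (sym b0)) a≁b
... | inj₂ a1 | inj₂ b1 | _       = contradiction (trans a1 (sym b1)) a≁b
... | _       | inj₁ b0 | inj₁ c0 = contradiction (trans b0 (sym c0)) b≁c
... | _       | inj₂ b1 | inj₂ c1 = contradiction (trans b1 (sym c1)) b≁c
... | inj₁ a0 | inj₂ _  | inj₁ c0 = trans c0 (sym a0)
... | inj₂ a1 | inj₁ _  | inj₂ c1 = trans c1 (sym a1)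

Odd⇒DiffParity-1-suc : ∀ {a} → Odd a → DiffParity 1 (suc a)
Odd⇒DiffParity-1-suc {a} a1 e = case trans e (trans ([1+a]%2≡1∸a%2 a) (cong (1 ∸_) a1)) of λ ()

DiffParity-suc-right : ∀ a → DiffParity a (suc a)
DiffParity-suc-right a e with %2≡0⊎%2≡1 a | trans e ([1+a]%2≡1∸a%2 a)
... | inj₁ a0 | e′ rewrite a0 = case e′ of λ ()
... | inj₂ a1 | e′ rewrite a1 = case e′ of λ ()

module _ {R : ℕ → ℕ → Set} where

  Linked-++⁺ : ∀ {a xs b ys} → Linked R (a ∷ xs) → R (lastOf a xs) b → Linked R (b ∷ ys) →
               Linked R (a ∷ xs ++ b ∷ ys)
  Linked-++⁺ {xs = []}     _          r l = r ∷ l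
  Linked-++⁺ {xs = x ∷ xs} (Rax ∷ l₁) r l = Rax ∷ Linked-++⁺ l₁ r l

  Linked-++⁻ : ∀ {a} xs {b ys} → Linked R (a ∷ xs ++ b ∷ ys) →
               Linked R (a ∷ xs) × R (lastOf a xs) b × Linked R (b ∷ ys)
  Linked-++⁻ []       (r ∷ l)   = [-] , r , l
  Linked-++⁻ (x ∷ xs) (Rax ∷ l) with Linked-++⁻ xs l
  ... | l₁ , r , l₂ = Rax ∷ l₁ , r , l₂

  Linked-suffix : ∀ xs {b ys} → Linked R (xs ++ b ∷ ys) → Linked R (b ∷ ys)
  Linked-suffix []       l = l
  Linked-suffix (x ∷ xs) l = proj₂ (proj₂ (Linked-++⁻ xs l))

map-suc-alternating : ∀ {xs} → ParityAlternating xs → ParityAlternating (map suc xs)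
map-suc-alternating = Linked.map⁺ ∘ Linked.map (λ {a} {b} → DiffParity-suc {a} {b})

evens : List ℕ → ℕ
evens xs = length (filter (λ a → a % 2 ≟ 0) xs)

evens-++ : ∀ xs ys → evens (xs ++ ys) ≡ evens xs + evens ys
evens-++ xs ys = trans (cong length (filter-++ (λ a → a % 2 ≟ 0) xs ys)) (length-++ (filter _ xs))

evens-∷-even : ∀ a xs → a % 2 ≡ 0 → evens (a ∷ xs) ≡ suc (evens xs)
evens-∷-even a xs a0 = cong length (filter-accept (λ a → a % 2 ≟ 0) {x = a} {xs = xs} a0)

evens-∷-odd : ∀ a xs → Odd a → evens (a ∷ xs) ≡ evens xs
evens-∷-odd a xs a1 =
  cong length (filter-reject (λ a → a % 2 ≟ 0) {x = a} {xs = xs} (λ a0 → case trans (sym a1) a0 of λ ()))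

evens-pair : ∀ {a b} → DiffParity a b → evens (a ∷ b ∷ []) ≡ 1
evens-pair {a} {b} a≁b with %2≡0⊎%2≡1 a | %2≡0⊎%2≡1 b
... | inj₁ a0 | inj₁ b0 = contradiction (trans a0 (sym b0)) a≁b
... | inj₂ a1 | inj₂ b1 = contradiction (trans a1 (sym b1)) a≁b
... | inj₁ a0 | inj₂ b1 = trans (evens-∷-even a _ a0) (cong suc (evens-∷-odd b [] b1))
... | inj₂ a1 | inj₁ b0 = trans (evens-∷-odd a _ a1) (evens-∷-even b [] b0)

private
  length-halve : ∀ {t k} → suc (suc k) ≡ suc t + suc t → k ≡ t + t
  length-halve {t} e = suc-injective (suc-injective (trans e (cong suc (+-suc t t))))

alternating-evens : ∀ t {xs} → Linked DiffParity xs → length xs ≡ t + t → evens xs ≡ t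
alternating-evens zero    {[]}           _         _   = refl
alternating-evens (suc t) {a ∷ b ∷ xs}   (a≁b ∷ l) len = begin
  evens (a ∷ b ∷ [] ++ xs)        ≡⟨ evens-++ (a ∷ b ∷ []) xs ⟩
  evens (a ∷ b ∷ []) + evens xs
    ≡⟨ cong₂ _+_ (evens-pair {a} {b} a≁b) (alternating-evens t (Linked.tail l) (length-halve len)) ⟩
  suc t                           ∎
  where open ≡-Reasoning
alternating-evens (suc t) {_ ∷ []} _ len = case suc-injective (trans len (cong suc (+-suc t t))) of λ ()

alternating-lastOf : ∀ t {a xs} → Linked DiffParity (a ∷ xs) → length xs ≡ t + t → lastOf a xs % 2 ≡ a % 2
alternating-lastOf zero    {xs = []}         _               _   = refl
alternating-lastOf (suc t) {a} {b ∷ c ∷ xs} (a≁b ∷ b≁c ∷ l) len =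
  trans (alternating-lastOf t l (length-halve len)) (DiffParity-twice {a} {b} {c} a≁b b≁c)
alternating-lastOf (suc t) {xs = _ ∷ []} _ len = case suc-injective (trans len (cong suc (+-suc t t))) of λ ()

evens-range : ∀ t → evens (range (suc (t + t))) ≡ t
evens-range t = alternating-evens t
  (applyUpTo⁺₂ (suc ∘ suc) (t + t) DiffParity-suc-right)
  (length-applyUpTo (suc ∘ suc) (t + t))

-- Permutations of [N]

range-∈ : ∀ {N a} → 1 ≤ a → a ≤ N → a ∈ range N
range-∈ {a = suc a} _ a≤N = ∈-applyUpTo⁺ suc a≤N

range-unique : ∀ N → Unique (range N)
range-unique N = Unique.applyUpTo⁺₁ suc N (λ i<j _ e → <⇒≢ i<j (suc-injective e))

words-complete : ∀ N L {w} → length w ≡ L → All (λ a → 1 ≤ a × a ≤ N) w → w ∈ words N L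
words-complete N zero    {[]}    _   _                     = here refl
words-complete N (suc L) {a ∷ w} len ((1≤a , a≤N) ∷ w-range) =
  ∈-concat⁺′ (∈-map⁺ (a ∷_) (words-complete N L (suc-injective len) w-range))
             (∈-map⁺ (λ b → map (b ∷_) (words N L)) (range-∈ 1≤a a≤N))

words-unique : ∀ N L → Unique (words N L)
words-unique N zero    = [] ∷ []
words-unique N (suc L) =
  Unique.concat⁺ (All.map⁺ (All.tabulate (λ _ → Unique.map⁺ ∷-injectiveʳ (words-unique N L))))
                 (AllPairs.map⁺ (AllPairs.map disjoint (range-unique N)))
  where
  disjoint : ∀ {a b} → a ≢ b → Disjoint (map (a ∷_) (words N L)) (map (b ∷_) (words N L))
  disjoint a≢b (p , q) with ∈-map⁻ (_ ∷_) p | ∈-map⁻ (_ ∷_) q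
  ... | _ , _ , refl | _ , _ , e = a≢b (∷-injectiveˡ e)

∈-perms⁺ : ∀ {N w} → IsPerm N w → w ∈ perms N
∈-perms⁺ {N} {w} w-perm@(len , w-range , _) = ∈-filter⁺ (isPerm? N) (words-complete N N len w-range) w-perm

∈-perms⁻ : ∀ {N w} → w ∈ perms N → IsPerm N w
∈-perms⁻ {N} = proj₂ ∘ ∈-filter⁻ (isPerm? N) {xs = words N N}

perms-unique : ∀ N → Unique (perms N)
perms-unique N = Unique.filter⁺ (isPerm? N) (words-unique N N)

Unique-++⁻ : ∀ (xs : List ℕ) {ys} → Unique (xs ++ ys) → Unique xs × Unique ys × Disjoint xs ys
Unique-++⁻ []       u          = [] , u , λ ()
Unique-++⁻ (x ∷ xs) (x∉ ∷ u) with Unique-++⁻ xs u | All.++⁻ xs x∉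
... | uxs , uys , disjoint | x∉xs , x∉ys = x∉xs ∷ uxs , uys , disjoint′
  where
  disjoint′ : Disjoint (x ∷ xs) _
  disjoint′ (here refl , q) = All.lookup x∉ys q refl
  disjoint′ (there p   , q) = disjoint (p , q)

record SplitAtMax (N : ℕ) (u v : List ℕ) : Set where
  field
    length-parts : length u + suc (length v) ≡ N
    u-range      : All (λ a → 1 ≤ a × a < N) u
    v-range      : All (λ a → 1 ≤ a × a < N) v
    u-unique     : Unique u
    v-unique     : Unique v
    disjoint     : Disjoint u v

IsPerm⇒SplitAtMax : ∀ {N} u v → IsPerm N (u ++ N ∷ v) → SplitAtMax N u v
IsPerm⇒SplitAtMax {N} u v (len , w-range , w-unique)
  with Unique-++⁻ u w-unique | All.++⁻ u w-range
... | u-unique , N∉v ∷ v-unique , disjoint | u-range , _ ∷ v-range = record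
  { length-parts = trans (sym (length-++ u)) len
  ; u-range      = below-N u-range (All.tabulate (λ a∈u a≡N → disjoint (a∈u , here a≡N)))
  ; v-range      = below-N v-range (All.tabulate (λ a∈v a≡N → All.lookup N∉v a∈v (sym a≡N)))
  ; u-unique     = u-unique
  ; v-unique     = v-unique
  ; disjoint     = λ (p , q) → disjoint (p , there q)
  }
  where
  below-N : ∀ {xs} → All (λ a → 1 ≤ a × a ≤ N) xs → All (_≢ N) xs → All (λ a → 1 ≤ a × a < N) xs
  below-N in-range ≢N = All.zipWith (λ ((1≤a , a≤N) , a≢N) → 1≤a , ≤∧≢⇒< a≤N a≢N) (in-range , ≢N)

max∉prefix : ∀ {N u v} → SplitAtMax N u v → N ∉ u
max∉prefix split N∈u = <-irrefl refl (proj₂ (All.lookup (SplitAtMax.u-range split) N∈u))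

N∈perm : ∀ {N w} → 1 ≤ N → IsPerm N w → N ∈ w
N∈perm {N} {w} N≥1 (len , w-range , w-unique) with DecMembership._∈?_ _≟_ N w
... | yes N∈w = N∈w
... | no  N∉w = contradiction (unique-⊆⇒length≤ _≟_ w-unique w⊆[N-1]) (<⇒≱ shorter)
  where
  shorter : length (range (N ∸ 1)) < length w
  shorter = subst₂ _<_ (sym (length-applyUpTo suc (N ∸ 1))) (sym len) (∸-monoʳ-< z<s N≥1)
  w⊆[N-1] : w ⊆ range (N ∸ 1)
  w⊆[N-1] a∈w with All.lookup w-range a∈w
  ... | 1≤a , a≤N = range-∈ 1≤a (≤-pred (subst (_ <_) (sym (m+[n∸m]≡n N≥1))
                                          (≤∧≢⇒< a≤N (λ a≡N → N∉w (subst (_∈ w) a≡N a∈w)))))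

evens-perm-≤ : ∀ {N w} → IsPerm N w → evens w ≤ evens (range N)
evens-perm-≤ {N} {w} (_ , w-range , w-unique) =
  unique-⊆⇒length≤ _≟_ (Unique.filter⁺ even? w-unique) even-in-range
  where
  even? = λ a → a % 2 ≟ 0
  even-in-range : filter even? w ⊆ filter even? (range N)
  even-in-range p with ∈-filter⁻ even? {xs = w} p
  ... | a∈w , a0 with All.lookup w-range a∈w
  ...   | 1≤a , a≤N = ∈-filter⁺ even? (range-∈ 1≤a a≤N) a0

-- Starting with an even entry would need t + 1 of the t even numbers in [2t + 1].
alternating-perm-head-odd : ∀ t {a xs} → IsPerm (suc (t + t)) (a ∷ xs) → ParityAlternating (a ∷ xs) → Odd a
alternating-perm-head-odd t {a} {xs} perm alt with %2≡0⊎%2≡1 a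
... | inj₂ a1 = a1
... | inj₁ a0 = contradiction (evens-perm-≤ perm) (<⇒≱ (subst₂ _<_ (sym (evens-range t)) (sym evens-w) (n<1+n t)))
  where
  evens-w : evens (a ∷ xs) ≡ suc t
  evens-w = trans (evens-∷-even a xs a0)
                  (cong suc (alternating-evens t (Linked.tail alt) (suc-injective (proj₁ perm))))

alternating-perm-last-odd : ∀ t {a xs} → IsPerm (suc (t + t)) (a ∷ xs) → ParityAlternating (a ∷ xs) →
                            Odd (lastOf a xs)
alternating-perm-last-odd t perm alt =
  trans (alternating-lastOf t alt (suc-injective (proj₁ perm))) (alternating-perm-head-odd t perm alt)

-- The cyclic shift

module Shift (N : ℕ) (N≥1 : 1 ≤ N) where

  cut : List ℕ → List ℕ × List ℕ
  cut []      = [] , []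
  cut (a ∷ w) with a ≟ N
  ... | yes _ = [] , w
  ... | no  _ = map₁ (a ∷_) (cut w)

  shiftParts : List ℕ → List ℕ → List ℕ
  shiftParts u v = map suc v ++ 1 ∷ map suc u

  -- On the cyclic word 0 u N v: add 1 modulo N + 1, then rotate to start at 0 again.
  shift : List ℕ → List ℕ
  shift w = shiftParts (proj₁ (cut w)) (proj₂ (cut w))

  cut-++ : ∀ u v → N ∉ u → cut (u ++ N ∷ v) ≡ (u , v)
  cut-++ []      v _   with N ≟ N
  ... | yes _   = refl
  ... | no  N≢N = contradiction refl N≢N
  cut-++ (a ∷ u) v N∉u with a ≟ N
  ... | yes a≡N = contradiction (here (sym a≡N)) N∉u
  ... | no  _   = cong (map₁ (a ∷_)) (cut-++ u v (N∉u ∘ there))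

  shift-++ : ∀ {u v} → SplitAtMax N u v → shift (u ++ N ∷ v) ≡ shiftParts u v
  shift-++ {u} {v} parts rewrite cut-++ u v (max∉prefix parts) = refl

  split-at-max : ∀ {w} → IsPerm N w → ∃ λ u → ∃ λ v → w ≡ u ++ N ∷ v × SplitAtMax N u v
  split-at-max w-perm with ∈-∃++ (N∈perm N≥1 w-perm)
  ... | u , v , refl = u , v , refl , IsPerm⇒SplitAtMax u v w-perm

  rotated-below-N : ∀ {u v} → SplitAtMax N u v → All (_< N) (v ++ 0 ∷ u)
  rotated-below-N parts = All.++⁺ (All.map proj₂ v-range) (N≥1 ∷ All.map proj₂ u-range)
    where open SplitAtMax parts

  shiftParts≡map-suc : ∀ u v → shiftParts u v ≡ map suc (v ++ 0 ∷ u)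
  shiftParts≡map-suc u v = sym (map-++ suc v (0 ∷ u))

  shiftParts-perm : ∀ {u v} → SplitAtMax N u v → IsPerm N (shiftParts u v)
  shiftParts-perm {u} {v} parts = subst (IsPerm N) (sym (shiftParts≡map-suc u v))
    ( trans (length-map suc (v ++ 0 ∷ u)) length-rotated
    , All.map⁺ (All.map (λ a<N → s≤s z≤n , a<N) (rotated-below-N parts))
    , Unique.map⁺ suc-injective (Unique.++⁺ v-unique (0∉u ∷ u-unique) disjoint′) )
    where
    open SplitAtMax parts
    length-rotated : length (v ++ 0 ∷ u) ≡ N
    length-rotated = begin
      length (v ++ 0 ∷ u)        ≡⟨ length-++ v ⟩
      length v + suc (length u)  ≡⟨ +-suc (length v) (length u) ⟩
      suc (length v + length u)  ≡⟨ cong suc (+-comm (length v) (length u)) ⟩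
      suc (length u + length v)  ≡⟨ +-suc (length u) (length v) ⟨
      length u + suc (length v)  ≡⟨ length-parts ⟩
      N                          ∎
      where open ≡-Reasoning
    0∉u : All (0 ≢_) u
    0∉u = All.map (<⇒≢ ∘ proj₁) u-range
    disjoint′ : Disjoint v (0 ∷ u)
    disjoint′ (a∈v , here refl) = <⇒≢ (proj₁ (All.lookup v-range a∈v)) refl
    disjoint′ (a∈v , there a∈u) = disjoint (a∈u , a∈v)

  shift-perm : ∀ {w} → IsPerm N w → IsPerm N (shift w)
  shift-perm w-perm with split-at-max w-perm
  ... | u , v , refl , parts rewrite shift-++ parts = shiftParts-perm parts

  ascents-split : ∀ {u v} → SplitAtMax N u v → ascents (u ++ N ∷ v) ≡ ascentsFrom 0 u + ascents v
  ascents-split {[]}    {v} parts = ascentsFrom-≥ v (All.map (<⇒≤ ∘ proj₂) (SplitAtMax.v-range parts))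
  ascents-split {a ∷ u} {v} parts = begin
    ascentsFrom a (u ++ N ∷ v)
      ≡⟨ ascentsFrom-++ a u N v ⟩
    ascentsFrom a u + ascent (lastOf a u) N + ascentsFrom N v
      ≡⟨ cong₂ (λ x y → ascentsFrom a u + x + y) (ascent-< last<N) (ascentsFrom-≥ v v≤N) ⟩
    ascentsFrom a u + 1 + ascents v
      ≡⟨ cong (_+ ascents v) (+-comm (ascentsFrom a u) 1) ⟩
    1 + ascentsFrom a u + ascents v
      ≡⟨ cong (λ x → x + ascentsFrom a u + ascents v) (ascent-< 1≤a) ⟨
    ascent 0 a + ascentsFrom a u + ascents v
      ∎
    where
    open ≡-Reasoning
    open SplitAtMax parts
    1≤a = proj₁ (All.lookup u-range (here refl))
    last<N = proj₂ (All.lookup u-range (lastOf-∈ a u))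
    v≤N = All.map (<⇒≤ ∘ proj₂) v-range

  ascents-shiftParts : ∀ u v → ascents (shiftParts u v) ≡ ascents v + ascentsFrom 0 u
  ascents-shiftParts u []      = ascentsFrom-map-suc 0 u
  ascents-shiftParts u (b ∷ v) = begin
    ascentsFrom (suc b) (map suc v ++ 1 ∷ map suc u)
      ≡⟨ ascentsFrom-++ (suc b) (map suc v) 1 (map suc u) ⟩
    ascentsFrom (suc b) (map suc v) + ascent (lastOf (suc b) (map suc v)) 1 + ascentsFrom 1 (map suc u)
      ≡⟨ cong₂ (λ x y → x + ascent y 1 + ascentsFrom 1 (map suc u)) (ascentsFrom-map-suc b v) (lastOf-map suc b v) ⟩
    ascentsFrom b v + ascent (suc (lastOf b v)) 1 + ascentsFrom 1 (map suc u)
      ≡⟨ cong₂ (λ x y → ascentsFrom b v + x + y) (ascent-≮ {suc (lastOf b v)} {1} λ { (s≤s ()) })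
                                                  (ascentsFrom-map-suc 0 u) ⟩
    ascentsFrom b v + 0 + ascentsFrom 0 u
      ≡⟨ cong (_+ ascentsFrom 0 u) (+-identityʳ _) ⟩
    ascentsFrom b v + ascentsFrom 0 u
      ∎
    where open ≡-Reasoning

  shift-ascents : ∀ {w} → IsPerm N w → ascents (shift w) ≡ ascents w
  shift-ascents w-perm with split-at-max w-perm
  ... | u , v , refl , parts rewrite shift-++ parts =
    trans (ascents-shiftParts u v) (trans (+-comm (ascents v) _) (sym (ascents-split parts)))

  n : ℕ
  n = suc N

  cyclic : List ℕ → ℕ → ℕ
  cyclic w i = nth (0 ∷ w) (i % n)

  cyclic<n : ∀ {w} → IsPerm N w → ∀ i → cyclic w i < n
  cyclic<n {w} (len , w-range , _) i =
    s≤s (All.lookup (z≤n ∷ All.map proj₂ w-range)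
                    (nth-∈ (0 ∷ w) (subst (i % n <_) (cong suc (sym len)) (m%n<n i n))))

  cyclic-periodic : ∀ w i → cyclic w (n + i) ≡ cyclic w i
  cyclic-periodic w i = cong (nth (0 ∷ w)) (trans (cong (_% n) (+-comm n i)) ([m+n]%n≡m%n i n))

  cyclic≡0⇒n∣ : ∀ {w} → IsPerm N w → ∀ i → cyclic w i ≡ 0 → n ∣ i
  cyclic≡0⇒n∣ {w} (len , w-range , _) i τi≡0 with i % n in i%n≡
  ... | zero  = m%n≡0⇒n∣m i n i%n≡
  ... | suc s = contradiction τi≡0 (≢-sym (<⇒≢ (proj₁ (All.lookup w-range (nth-∈ w s<w)))))
    where
    s<w : s < length w
    s<w = subst (s <_) (sym len) (≤-pred (subst (_< n) i%n≡ (m%n<n i n)))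

  private
    map-suc%n : ∀ {xs} → All (_< N) xs → map (λ a → suc a % n) xs ≡ map suc xs
    map-suc%n []           = refl
    map-suc%n (a<N ∷ xs<N) = cong₂ _∷_ (m<n⇒m%n≡m (s≤s a<N)) (map-suc%n xs<N)

  shift-cyclic : ∀ {w} → IsPerm N w → ∃ λ r → ∀ i → cyclic (shift w) i ≡ suc (cyclic w (r + i)) % n
  shift-cyclic w-perm with split-at-max w-perm
  ... | u , v , refl , parts rewrite shift-++ parts = length P , λ i → begin
    nth (0 ∷ shiftParts u v) (i % n)              ≡⟨ cong (λ xs → nth xs (i % n)) rotated ⟩
    nth (map S (Q ++ P)) (i % n)                  ≡⟨ nth-map S (Q ++ P) (subst (i % n <_) (sym length-QP) (m%n<n i n)) ⟩
    S (nth (Q ++ P) (i % n))                      ≡⟨ cong S (nth-rotate P Q length-PQ (m%n<n i n)) ⟩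
    S (nth (P ++ Q) ((length P + i % n) % n))
      ≡⟨ cong (S ∘ nth (P ++ Q)) (%-+-congʳ (length P) {i % n} {i} {n} (m%n%n≡m%n i n)) ⟩
    S (nth (P ++ Q) ((length P + i) % n))         ∎
    where
    open ≡-Reasoning
    S = λ a → suc a % n
    P = 0 ∷ u
    Q = N ∷ v
    length-PQ : length P + length Q ≡ n
    length-PQ = trans (sym (length-++ P)) (cong suc (proj₁ w-perm))
    length-QP : length (Q ++ P) ≡ n
    length-QP = trans (length-++ Q) (trans (+-comm (length Q) (length P)) length-PQ)
    rotated : 0 ∷ shiftParts u v ≡ map S (Q ++ P)
    rotated = cong₂ _∷_ (sym (n%n≡0 n))
                (trans (shiftParts≡map-suc u v) (sym (map-suc%n (rotated-below-N parts))))

  cyclic-injective : ∀ {w w′} → IsPerm N w → IsPerm N w′ → (∀ i → cyclic w i ≡ cyclic w′ i) → w ≡ w′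
  cyclic-injective {w} {w′} w-perm w′-perm same = ∷-injectiveʳ (nth-ext (0 ∷ w) (0 ∷ w′) len agree)
    where
    len : length (0 ∷ w) ≡ length (0 ∷ w′)
    len = cong suc (trans (proj₁ w-perm) (sym (proj₁ w′-perm)))
    agree : ∀ {i} → i < length (0 ∷ w) → nth (0 ∷ w) i ≡ nth (0 ∷ w′) i
    agree {i} i<n = subst (λ j → nth (0 ∷ w) j ≡ nth (0 ∷ w′) j)
                      (m<n⇒m%n≡m (subst (i <_) (cong suc (proj₁ w-perm)) i<n)) (same i)

  open Orbits (≡-dec _≟_) shift using (iter)

  iter-perm : ∀ {w} → IsPerm N w → ∀ j → IsPerm N (iter j w)
  iter-perm w-perm zero    = w-perm
  iter-perm w-perm (suc j) = shift-perm (iter-perm w-perm j)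

  iter-cyclic : ∀ {w} → IsPerm N w → ∀ j → ∃ λ r → ∀ i → cyclic (iter j w) i ≡ (cyclic w (r + i) + j) % n
  iter-cyclic {w} w-perm zero =
    0 , λ i → sym (trans (cong (_% n) (+-identityʳ (cyclic w i))) (m<n⇒m%n≡m (cyclic<n w-perm i)))
  iter-cyclic {w} w-perm (suc j) with iter-cyclic w-perm j | shift-cyclic (iter-perm w-perm j)
  ... | r , iter-j | r′ , shift-once = r + r′ , step
    where
    step : ∀ i → cyclic (shift (iter j w)) i ≡ (cyclic w (r + r′ + i) + suc j) % n
    step i = begin
      cyclic (shift (iter j w)) i                 ≡⟨ shift-once i ⟩
      suc (cyclic (iter j w) (r′ + i)) % n        ≡⟨ cong (λ y → suc y % n) (iter-j (r′ + i)) ⟩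
      suc (x % n) % n                             ≡⟨ %-+-congʳ 1 {x % n} {x} {n} (m%n%n≡m%n x n) ⟩
      suc x % n                                   ≡⟨ cong (_% n) (+-suc _ j) ⟨
      (cyclic w (r + (r′ + i)) + suc j) % n       ≡⟨ cong (λ z → (cyclic w z + suc j) % n) (+-assoc r r′ i) ⟨
      (cyclic w (r + r′ + i) + suc j) % n         ∎
      where
      open ≡-Reasoning
      x = cyclic w (r + (r′ + i)) + j

  iter-n : ∀ {w} → IsPerm N w → iter n w ≡ w
  iter-n {w} w-perm with iter-cyclic w-perm n
  ... | r , iter-n-cyclic = cyclic-injective (iter-perm w-perm n) w-perm (λ i → trans (rotated-by-r i) (unrotate i))
    where
    rotated-by-r : ∀ i → cyclic (iter n w) i ≡ cyclic w (r + i)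
    rotated-by-r i =
      trans (iter-n-cyclic i) (trans ([m+n]%n≡m%n (cyclic w (r + i)) n) (m<n⇒m%n≡m (cyclic<n w-perm (r + i))))
    n∣r : n ∣ r
    n∣r = subst (n ∣_) (+-identityʳ r) (cyclic≡0⇒n∣ w-perm (r + 0) (sym (rotated-by-r 0)))
    unrotate : ∀ i → cyclic w (r + i) ≡ cyclic w i
    unrotate i = cong (nth (0 ∷ w)) (%-remove-+ˡ i n∣r)

  cyclic-ascents : ∀ {w} → IsPerm N w → ascentsUpTo (cyclic w) n ≡ suc (ascents w)
  cyclic-ascents {[]}    (len , _) = contradiction (trans len (sym (m+[n∸m]≡n N≥1))) λ ()
  cyclic-ascents {b ∷ w} (len , (1≤b , _) ∷ _ , _) = begin
    ascentsUpTo (cyclic (b ∷ w)) N + ascent (cyclic (b ∷ w) N) (cyclic (b ∷ w) n)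
      ≡⟨ cong₂ _+_ first-N (ascent-≮ {cyclic (b ∷ w) N} {cyclic (b ∷ w) n} no-ascent-into-0) ⟩
    ascentsFrom 0 (b ∷ w) + 0                                   ≡⟨ +-identityʳ _ ⟩
    ascent 0 b + ascentsFrom b w                                ≡⟨ cong (_+ ascentsFrom b w) (ascent-< 1≤b) ⟩
    suc (ascentsFrom b w)                                       ∎
    where
    open ≡-Reasoning
    wrap-to-0 : cyclic (b ∷ w) n ≡ 0
    wrap-to-0 = cong (nth (0 ∷ b ∷ w)) (n%n≡0 n)
    no-ascent-into-0 : ¬ cyclic (b ∷ w) N < cyclic (b ∷ w) n
    no-ascent-into-0 lt = case subst (cyclic (b ∷ w) N <_) wrap-to-0 lt of λ ()
    first-N : ascentsUpTo (cyclic (b ∷ w)) N ≡ ascentsFrom 0 (b ∷ w)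
    first-N = trans (ascentsUpTo-cong _ _ N (λ k≤N → cong (nth (0 ∷ b ∷ w)) (m≤n⇒m%n≡m k≤N)))
                    (trans (cong (ascentsUpTo (nth (0 ∷ b ∷ w))) (sym len)) (sym (ascentsFrom≡ascentsUpTo 0 (b ∷ w))))

  periods-divisible : ∀ {p} m .{{_ : NonZero p}} → p ^ m ∣ n → ∀ {w} → IsPerm N w → p ∣ suc (ascents w) →
                      Orbits.PeriodsDivisibleBy (≡-dec _≟_) shift (p ^ m) w
  periods-divisible {p} m p^m∣n {w} w-perm p∣k {j} iter-j-w≡w with iter-cyclic w-perm j
  ... | r , rotated = CyclicSequence.p^m∣j n (cyclic w) (cyclic<n w-perm) (cyclic-periodic w) refl
                        (cyclic≡0⇒n∣ w-perm) {r} {j} invariant {p}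
                        (subst (p ∣_) (sym (cyclic-ascents w-perm)) p∣k) m p^m∣n
    where
    invariant : ∀ i → cyclic w i ≡ (cyclic w (r + i) + j) % n
    invariant i = trans (cong (λ x → cyclic x i) (sym iter-j-w≡w)) (rotated i)

  p^m∣count : ∀ {Q : Pred (List ℕ) 0ℓ} (Q? : Decidable Q) {p} m .{{_ : NonZero p}} → p ^ m ∣ n →
              (∀ {w} → IsPerm N w → Q w → Q (shift w)) → (∀ {w} → IsPerm N w → Q w → p ∣ suc (ascents w)) →
              p ^ m ∣ length (filter Q? (perms N))
  p^m∣count {Q} Q? {p} m p^m∣n preserved p∣k =
    Orbits.∣-length-of-invariant (≡-dec _≟_) shift (p ^ m) {n} (s≤s z≤n) L
      (Unique.filter⁺ Q? (perms-unique N)) closed (iter-n ∘ perm)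
      (λ x∈L → periods-divisible m p^m∣n (perm x∈L) (p∣k (perm x∈L) (holds x∈L)))
    where
    L = filter Q? (perms N)
    perm : ∀ {x} → x ∈ L → IsPerm N x
    perm = ∈-perms⁻ ∘ proj₁ ∘ ∈-filter⁻ Q? {xs = perms N}
    holds : ∀ {x} → x ∈ L → Q x
    holds = proj₂ ∘ ∈-filter⁻ Q? {xs = perms N}
    closed : ∀ {x} → x ∈ L → shift x ∈ L
    closed x∈L = ∈-filter⁺ Q? (∈-perms⁺ (shift-perm (perm x∈L))) (preserved (perm x∈L) (holds x∈L))

  module _ {t} (N≡2t+1 : N ≡ suc (t + t)) where

    private
      odd-length : ∀ w → IsPerm N w → IsPerm (suc (t + t)) w
      odd-length w = subst (λ M → IsPerm M w) N≡2t+1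

      last-odd : ∀ xs {b ys} → IsPerm N (xs ++ b ∷ ys) → ParityAlternating (xs ++ b ∷ ys) → Odd (lastOf b ys)
      last-odd []       {b} {ys} perm alt = alternating-perm-last-odd t (odd-length (b ∷ ys) perm) alt
      last-odd (a ∷ xs) {b} {ys} perm alt =
        subst Odd (lastOf-++ a xs b ys) (alternating-perm-last-odd t (odd-length (a ∷ xs ++ b ∷ ys) perm) alt)

      one-then-suc : ∀ u {v} → IsPerm N (u ++ N ∷ v) → ParityAlternating (u ++ N ∷ v) →
                     ParityAlternating (1 ∷ map suc u)
      one-then-suc []      _    _   = [-]
      one-then-suc (a ∷ u) {v} perm alt =
        Odd⇒DiffParity-1-suc {a} (alternating-perm-head-odd t (odd-length (a ∷ u ++ N ∷ v) perm) alt)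
        ∷ map-suc-alternating (proj₁ (Linked-++⁻ u alt))

    shiftParts-alternating : ∀ u v → IsPerm N (u ++ N ∷ v) → ParityAlternating (u ++ N ∷ v) →
                             ParityAlternating (shiftParts u v)
    shiftParts-alternating u []      perm alt = one-then-suc u perm alt
    shiftParts-alternating u (b ∷ v) perm alt =
      Linked-++⁺ (map-suc-alternating (Linked.tail (Linked-suffix u alt))) last-to-1 (one-then-suc u perm alt)
      where
      last-to-1 : DiffParity (lastOf (suc b) (map suc v)) 1
      last-to-1 = subst (λ x → DiffParity x 1) (sym (lastOf-map suc b v))
                        (≢-sym (Odd⇒DiffParity-1-suc {lastOf b v} (last-odd u perm alt)))

    shift-alternating : ∀ {w} → IsPerm N w → ParityAlternating w → ParityAlternating (shift w)
    shift-alternating w-perm alt with split-at-max w-perm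
    ... | u , v , refl , parts rewrite shift-++ parts = shiftParts-alternating u v w-perm alt

    iter-alternating : ∀ {w} → IsPerm N w → ParityAlternating w → ∀ j → ParityAlternating (iter j w)
    iter-alternating w-perm alt zero    = alt
    iter-alternating w-perm alt (suc j) = shift-alternating (iter-perm w-perm j) (iter-alternating w-perm alt j)

    -- Since shift has order n, it maps the complement of the alternating permutations into itself too.
    shift-non-alternating : ∀ {w} → IsPerm N w → ¬ ParityAlternating w → ¬ ParityAlternating (shift w)
    shift-non-alternating {w} w-perm ¬alt alt′ =
      ¬alt (subst ParityAlternating (trans (sym (Orbits.iter-suc (≡-dec _≟_) shift N w)) (iter-n w-perm))
                  (iter-alternating (shift-perm w-perm) alt′ N))

    𝒫-divisible : ∀ {p} m k .{{_ : NonZero p}} → p ^ m ∣ n → p ∣ suc k → p ^ m ∣ 𝒫 N k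
    𝒫-divisible m k p^m∣n p∣k = p^m∣count _ m p^m∣n
      (λ w-perm (alt , asc) → shift-alternating w-perm alt , trans (shift-ascents w-perm) asc)
      (λ _ (_ , asc) → subst (λ a → _ ∣ suc a) (sym asc) p∣k)

    𝒩-divisible : ∀ {p} m k .{{_ : NonZero p}} → p ^ m ∣ n → p ∣ suc k → p ^ m ∣ 𝒩 N k
    𝒩-divisible m k p^m∣n p∣k = p^m∣count _ m p^m∣n
      (λ w-perm (¬alt , asc) → shift-non-alternating w-perm ¬alt , trans (shift-ascents w-perm) asc)
      (λ _ (_ , asc) → subst (λ a → _ ∣ suc a) (sym asc) p∣k)

odd-predecessor : ∀ N → 2 ∣ suc N → ∃ λ t → N ≡ suc (t + t)
odd-predecessor N (divides (suc t) 1+N≡[1+t]*2) =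
  t , suc-injective (trans 1+N≡[1+t]*2 (cong (suc ∘ suc) (trans (*-comm t 2) (cong (t +_) (+-identityʳ t)))))

theorem5 : (p m n k : ℕ) → Prime p → 1 ≤ m → 1 ≤ n → 2 ∣ n → p ^ m ∣ n →
    1 ≤ k → k ≤ n ∸ 1 → p ∣ k →
    (p ^ m ∣ 𝒫 (n ∸ 1) (k ∸ 1)) × (p ^ m ∣ 𝒩 (n ∸ 1) (k ∸ 1))
theorem5 p m zero    k _       _ () _   _     _   _ _
theorem5 p m (suc N) k p-prime _ _ 2∣n p^m∣n 1≤k _ p∣k =
  𝒫-divisible {t} N≡2t+1 m (k ∸ 1) p^m∣n p∣1+[k-1] , 𝒩-divisible {t} N≡2t+1 m (k ∸ 1) p^m∣n p∣1+[k-1]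
  where
  instance
    p≢0 : NonZero p
    p≢0 = prime⇒nonZero p-prime
  t : ℕ
  t = proj₁ (odd-predecessor N 2∣n)
  N≡2t+1 : N ≡ suc (t + t)
  N≡2t+1 = proj₂ (odd-predecessor N 2∣n)
  open Shift N (subst (1 ≤_) (sym N≡2t+1) (s≤s z≤n))
  p∣1+[k-1] : p ∣ suc (k ∸ 1)
  p∣1+[k-1] = subst (p ∣_) (sym (m+[n∸m]≡n 1≤k)) p∣k
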